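{- If $n\ge 2$ and $m\ge 4$, then $\det(B_{m,n})=n-1$.
   Context: The book graph $B_{m,n}$ consists of $n$ copies of the cycle $C_m$ identified along a single common edge. A determining set for a graph $G$ is a set $S\subseteq V(G)$ such that the only automorphism of $G$ fixing every vertex of $S$ is the identity; $\det(G)$ is the minimum size of a determining set. -}

module Defs where

open import Level using (0ℓ)
open import Data.Nat using (ℕ; zero; suc; _∸_; _≤_)
open import Data.Fin using (Fin; toℕ) renaming (zero to fzero; suc to fsuc)
open import Data.Sum using (_⊎_; inj₁; inj₂)
open import Data.Product using (_×_; _,_; Σ; ∃-syntax)
open import Data.List using (List; length)
open import Data.List.Membership.Propositional using (_∈_)
open import Data.List.Relation.Unary.Unique.Propositional using (Unique)
open import Function.Bundles using (_↔_; _⇔_; Inverse)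
open import Relation.Binary.PropositionalEquality using (_≡_)

record Graph : Set₁ where
  field
    V   : Set
    Adj : V → V → Set

open Graph public

record Automorphism (G : Graph) : Set where
  field
    perm     : V G ↔ V G
    preserve : ∀ x y → Adj G x y ⇔ Adj G (Inverse.to perm x) (Inverse.to perm y)

open Automorphism public

apply : {G : Graph} → Automorphism G → V G → V G
apply φ = Inverse.to (perm φ)

IsDeterminingSet : (G : Graph) → List (V G) → Set
IsDeterminingSet G S =
  (φ : Automorphism G) → (∀ s → s ∈ S → apply φ s ≡ s) → ∀ x → apply φ x ≡ x

DetEquals : (G : Graph) → ℕ → Set
DetEquals G k =
  (∃[ S ] (Unique S × length S ≡ k × IsDeterminingSet G S))
  × (∀ (S : List (V G)) → Unique S → IsDeterminingSet G S → k ≤ length S)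

-- Book graph B_{m,n}: vertices are the two endpoints of the common edge
-- (inj₁ 0 = u, inj₁ 1 = v) and, for each page i < n, the m-2 interior
-- vertices p_{i,0}, …, p_{i,m-3} of the i-th copy of C_m, whose cycle is
-- u – p_{i,0} – p_{i,1} – … – p_{i,m-3} – v – u.
BookV : ℕ → ℕ → Set
BookV m n = Fin 2 ⊎ (Fin n × Fin (m ∸ 2))

data BookEdge (m n : ℕ) : BookV m n → BookV m n → Set where
  hinge : BookEdge m n (inj₁ fzero) (inj₁ (fsuc fzero))
  start : (i : Fin n) (j : Fin (m ∸ 2)) → toℕ j ≡ 0 →
          BookEdge m n (inj₁ fzero) (inj₂ (i , j))
  step  : (i : Fin n) (j j′ : Fin (m ∸ 2)) → toℕ j′ ≡ suc (toℕ j) →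
          BookEdge m n (inj₂ (i , j)) (inj₂ (i , j′))
  end   : (i : Fin n) (j : Fin (m ∸ 2)) → suc (toℕ j) ≡ m ∸ 2 →
          BookEdge m n (inj₂ (i , j)) (inj₁ (fsuc fzero))

Book : ℕ → ℕ → Graph
Book m n = record
  { V   = BookV m n
  ; Adj = λ x y → BookEdge m n x y ⊎ BookEdge m n y x
  }

{-# OPTIONS --safe #-}
-- Fixing a vertex of degree two and one of its neighbours fixes the other neighbour, so an
-- automorphism fixing u and the first interior vertex of a page fixes that whole page cycle.
-- Fixing the first interior vertex of every page but page 0 forces u to be fixed (this is
-- where m ≥ 4 enters), hence those pages and v; the first vertex of page 0 is then the one
-- neighbour of u not yet known to be fixed, so page 0 is fixed too. Conversely, fewer than
-- n - 1 vertices miss two pages, and swapping those pages is a non-trivial automorphism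
-- fixing them all.
module Submission where

open import Defs
open import Data.Nat using (ℕ; zero; suc; _≤_; _<_; _∸_; z≤n; s≤s; _<?_)
open import Data.Nat.Properties using (m≤n⇒m≤1+n; ≤-refl; ≤-trans; n≤1+n; <-irrefl; ≤∧≮⇒≡; ≮⇒≥)
open import Data.Fin using (Fin; toℕ; fromℕ<) renaming (zero to fzero; suc to fsuc)
open import Data.Fin.Properties using (fromℕ<-toℕ; toℕ<n; toℕ-fromℕ<; ¬∀⟶∃¬; pigeonhole; suc-injective; _≟_)
open import Data.Fin.Permutation using (Permutation′; _⟨$⟩ʳ_; _⟨$⟩ˡ_; inverseˡ; inverseʳ; transpose)
import Data.Fin.Permutation.Components as PC
open import Data.Maybe using (Maybe; just; nothing)
open import Data.Maybe.Properties using (just-injective)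
import Data.Maybe.Relation.Unary.Any as MaybeAny
open import Data.Sum using (_⊎_; inj₁; inj₂) renaming (map to ⊎-map)
open import Data.Product using (_×_; _,_; ∃-syntax; proj₁; proj₂)
open import Data.List using (List; _∷_; length; map; mapMaybe; allFin; lookup)
open import Data.List.Membership.Propositional using (_∈_; _∉_)
open import Data.List.Membership.Propositional.Properties using (∈-map⁺; ∈-allFin)
import Data.List.Membership.DecPropositional as DecMembership
open import Data.List.Relation.Unary.Any using (here; there; index) renaming (map to any-map)
open import Data.List.Relation.Unary.Any.Properties using (lookup-index; mapMaybe⁺)
open import Data.List.Relation.Unary.Unique.Propositional using (Unique)
open import Data.List.Relation.Unary.Unique.Propositional.Properties using (map⁺; allFin⁺)
open import Data.List.Properties using (length-map; length-tabulate; length-mapMaybe)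
open import Data.Empty using (⊥-elim)
open import Function using (_∘_)
open import Relation.Nullary using (¬_; yes; no)
open import Function.Bundles using (Inverse; Equivalence; mk↔ₛ′; mk⇔)
open import Relation.Binary.PropositionalEquality using (_≡_; _≢_; refl; sym; trans; cong; subst; subst₂)

module _ {G : Graph} (φ : Automorphism G) where

  Fixed : V G → Set
  Fixed x = apply φ x ≡ x

  apply-injective : ∀ {x y} → apply φ x ≡ apply φ y → x ≡ y
  apply-injective {x} {y} eq = trans (sym (Inverse.strictlyInverseʳ (perm φ) x))
    (trans (cong (Inverse.from (perm φ)) eq) (Inverse.strictlyInverseʳ (perm φ) y))

  apply-Adj : ∀ {x y} → Adj G x y → Adj G (apply φ x) (apply φ y)
  apply-Adj {x} {y} = Equivalence.to (preserve φ x y)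

  apply-Adj-fixed : ∀ {x y} → Fixed x → Adj G x y → Adj G x (apply φ y)
  apply-Adj-fixed {y = y} fx xy = subst (λ w → Adj G w (apply φ y)) fx (apply-Adj xy)

  fixed-neighbour : ∀ {x y} → Fixed x → Adj G x y →
                    (∀ z → Adj G x z → z ≡ y ⊎ Fixed z) → Fixed y
  fixed-neighbour {y = y} fx xy others with others (apply φ y) (apply-Adj-fixed fx xy)
  ... | inj₁ φy≡y = φy≡y
  ... | inj₂ φφy≡φy = apply-injective φφy≡φy

  fixed-along-path : (c : ℕ → V G) (ℓ : ℕ) →
    (∀ t → t < ℓ → Adj G (c (suc t)) (c (suc (suc t)))) →
    (∀ t → t < ℓ → ∀ z → Adj G (c (suc t)) z → z ≡ c t ⊎ z ≡ c (suc (suc t))) →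
    Fixed (c 0) → Fixed (c 1) → ∀ t → t ≤ suc ℓ → Fixed (c t)
  fixed-along-path c ℓ adjacent neighbours f₀ f₁ = fixed
    where
    consecutive : ∀ t → t ≤ ℓ → Fixed (c t) × Fixed (c (suc t))
    consecutive zero    _   = f₀ , f₁
    consecutive (suc t) t<ℓ = fₜ₊₁ , fixed-neighbour fₜ₊₁ (adjacent t t<ℓ) others
      where
      previous : Fixed (c t) × Fixed (c (suc t))
      previous = consecutive t (≤-trans (n≤1+n t) t<ℓ)

      fₜ₊₁ : Fixed (c (suc t))
      fₜ₊₁ = proj₂ previous

      others : ∀ z → Adj G (c (suc t)) z → z ≡ c (suc (suc t)) ⊎ Fixed z
      others z adj with neighbours t t<ℓ z adj
      ... | inj₁ refl = inj₂ (proj₁ previous)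
      ... | inj₂ refl = inj₁ refl

    fixed : ∀ t → t ≤ suc ℓ → Fixed (c t)
    fixed zero    _         = f₀
    fixed (suc t) (s≤s t≤ℓ) = proj₂ (consecutive t t≤ℓ)

length<⇒∃∉ : ∀ {n} (L : List (Fin n)) → length L < n → ∃[ i ] i ∉ L
length<⇒∃∉ {n} L |L|<n = ¬∀⟶∃¬ n (_∈ L) (λ i → DecMembership._∈?_ _≟_ i L) not-all
  where
  not-all : ¬ (∀ i → i ∈ L)
  not-all all∈ with pigeonhole |L|<n (λ i → index (all∈ i))
  ... | i , j , i<j , same-index = <-irrefl (cong toℕ i≡j) i<j
    where
    i≡j : i ≡ j
    i≡j = trans (lookup-index (all∈ i))
            (trans (cong (lookup L) same-index) (sym (lookup-index (all∈ j))))

length<⇒∃₂∉ : ∀ {n} (L : List (Fin n)) → suc (length L) < n →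
              ∃[ a ] ∃[ b ] a ≢ b × a ∉ L × b ∉ L
length<⇒∃₂∉ L |L|<n with length<⇒∃∉ L (≤-trans (n≤1+n _) |L|<n)
... | a , a∉L with length<⇒∃∉ (a ∷ L) |L|<n
... | b , b∉a∷L = a , b , (λ a≡b → b∉a∷L (here (sym a≡b))) , a∉L , (λ b∈L → b∉a∷L (there b∈L))

transpose-matchˡ : ∀ {n} (a b : Fin n) → PC.transpose a b a ≡ b
transpose-matchˡ a b with a ≟ a
... | yes _   = refl
... | no  a≢a = ⊥-elim (a≢a refl)

transpose-mismatch : ∀ {n} (a b k : Fin n) → k ≢ a → k ≢ b → PC.transpose a b k ≡ k
transpose-mismatch a b k k≢a k≢b with k ≟ a
... | yes k≡a = ⊥-elim (k≢a k≡a)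
... | no  _ with k ≟ b
...   | yes k≡b = ⊥-elim (k≢b k≡b)
...   | no  _   = refl

module BookGraph (m n : ℕ) where

  u v : BookV m n
  u = inj₁ fzero
  v = inj₁ (fsuc fzero)

  p : Fin n → Fin (m ∸ 2) → BookV m n
  p i j = inj₂ (i , j)

  relabelPages : (Fin n → Fin n) → BookV m n → BookV m n
  relabelPages π (inj₁ c)       = inj₁ c
  relabelPages π (inj₂ (i , j)) = inj₂ (π i , j)

  relabelPages-BookEdge : ∀ π {x y} → BookEdge m n x y →
                          BookEdge m n (relabelPages π x) (relabelPages π y)
  relabelPages-BookEdge π hinge           = hinge
  relabelPages-BookEdge π (start i j e)   = start (π i) j e
  relabelPages-BookEdge π (step i j j′ e) = step (π i) j j′ e
  relabelPages-BookEdge π (end i j e)     = end (π i) j e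

  permutePages : Permutation′ n → Automorphism (Book m n)
  permutePages π = record
    { perm     = mk↔ₛ′ (relabelPages (π ⟨$⟩ʳ_)) (relabelPages (π ⟨$⟩ˡ_)) to∘from from∘to
    ; preserve = λ x y → mk⇔ (relabelAdj (π ⟨$⟩ʳ_))
        (λ adj → subst₂ (Adj (Book m n)) (from∘to x) (from∘to y) (relabelAdj (π ⟨$⟩ˡ_) adj))
    }
    where
    relabelAdj : ∀ σ {x y} → Adj (Book m n) x y →
                 Adj (Book m n) (relabelPages σ x) (relabelPages σ y)
    relabelAdj σ = ⊎-map (relabelPages-BookEdge σ) (relabelPages-BookEdge σ)

    to∘from : ∀ x → relabelPages (π ⟨$⟩ʳ_) (relabelPages (π ⟨$⟩ˡ_) x) ≡ x
    to∘from (inj₁ c)       = refl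
    to∘from (inj₂ (i , j)) = cong (λ i′ → inj₂ (i′ , j)) (inverseʳ π)

    from∘to : ∀ x → relabelPages (π ⟨$⟩ˡ_) (relabelPages (π ⟨$⟩ʳ_) x) ≡ x
    from∘to (inj₁ c)       = refl
    from∘to (inj₂ (i , j)) = cong (λ i′ → inj₂ (i′ , j)) (inverseˡ π)

  pageOf : BookV m n → Maybe (Fin n)
  pageOf (inj₁ _)       = nothing
  pageOf (inj₂ (i , _)) = just i

  pagesOf : List (BookV m n) → List (Fin n)
  pagesOf = mapMaybe pageOf

  length-pagesOf : ∀ T → length (pagesOf T) ≤ length T
  length-pagesOf = length-mapMaybe pageOf

  ∈-pagesOf : ∀ {T i j} → p i j ∈ T → i ∈ pagesOf T
  ∈-pagesOf {T} pij∈T =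
    mapMaybe⁺ pageOf T (any-map (λ { refl → MaybeAny.just refl }) (∈-map⁺ pageOf pij∈T))

  untouched-pages-not-determining : ∀ T {a b} → a ≢ b → a ∉ pagesOf T → b ∉ pagesOf T →
                                    Fin (m ∸ 2) → ¬ IsDeterminingSet (Book m n) T
  untouched-pages-not-determining T {a} {b} a≢b a∉ b∉ j₀ determining =
    a≢b (sym (trans (sym (transpose-matchˡ a b)) swap-fixes-a))
    where
    swap : Automorphism (Book m n)
    swap = permutePages (transpose a b)

    swap-fixes-T : ∀ s → s ∈ T → apply swap s ≡ s
    swap-fixes-T (inj₁ _)       _   = refl
    swap-fixes-T (inj₂ (i , j)) s∈T = cong (λ i′ → inj₂ (i′ , j))
      (transpose-mismatch a b i (λ { refl → a∉ (∈-pagesOf s∈T) }) (λ { refl → b∉ (∈-pagesOf s∈T) }))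

    swap-fixes-a : PC.transpose a b a ≡ a
    swap-fixes-a = just-injective (cong pageOf (determining swap swap-fixes-T (p a j₀)))

det-lower-bound : ∀ k n (T : List (BookV (suc (suc (suc k))) (suc n))) →
                  IsDeterminingSet (Book (suc (suc (suc k))) (suc n)) T → n ≤ length T
det-lower-bound k n T determining = ≮⇒≥ short-fails
  where
  open BookGraph (suc (suc (suc k))) (suc n)

  short-fails : ¬ (length T < n)
  short-fails |T|<n =
    let a , b , a≢b , a∉ , b∉ = length<⇒∃₂∉ (pagesOf T) (s≤s (≤-trans (s≤s (length-pagesOf T)) |T|<n))
    in untouched-pages-not-determining T a≢b a∉ b∉ fzero determining

module PageWalk (k n : ℕ) where
  open BookGraph (suc (suc k)) n

  B : Graph
  B = Book (suc (suc k)) n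

  -- walk i 0, walk i 1, …, walk i (suc k) is the i-th page cycle read from u to v
  -- (and walk i t = v for all larger t).
  walk : Fin n → ℕ → BookV (suc (suc k)) n
  walk i zero = u
  walk i (suc t) with t <? k
  ... | yes t<k = p i (fromℕ< t<k)
  ... | no  _   = v

  walk-interior : ∀ i {t} (j : Fin k) → toℕ j ≡ t → walk i (suc t) ≡ p i j
  walk-interior i j refl with toℕ j <? k
  ... | yes j<k = cong (p i) (fromℕ<-toℕ j j<k)
  ... | no  j≮k = ⊥-elim (j≮k (toℕ<n j))

  walk-end : ∀ i → walk i (suc k) ≡ v
  walk-end i with k <? k
  ... | yes k<k = ⊥-elim (<-irrefl refl k<k)
  ... | no  _   = refl

  walk-adjacent : ∀ i t → t < k → Adj B (walk i (suc t)) (walk i (suc (suc t)))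
  walk-adjacent i t t<k with t <? k | suc t <? k
  ... | no  t≮k  | _         = ⊥-elim (t≮k t<k)
  ... | yes t<k′ | yes t+1<k =
    inj₁ (step i _ _ (trans (toℕ-fromℕ< t+1<k) (cong suc (sym (toℕ-fromℕ< t<k′)))))
  ... | yes t<k′ | no  t+1≮k =
    inj₁ (end i _ (trans (cong suc (toℕ-fromℕ< t<k′)) (≤∧≮⇒≡ t<k t+1≮k)))

  p-neighbours : ∀ i j {t} → toℕ j ≡ t → ∀ z → Adj B (p i j) z →
                 z ≡ walk i t ⊎ z ≡ walk i (suc (suc t))
  p-neighbours i j refl _ (inj₁ (step .i .j j′ e)) = inj₂ (sym (walk-interior i j′ e))
  p-neighbours i j refl _ (inj₁ (end .i .j e))     = inj₂ (sym (trans (cong (walk i ∘ suc) e) (walk-end i)))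
  p-neighbours i j refl _ (inj₂ (start .i .j e))   = inj₁ (sym (cong (walk i) e))
  p-neighbours i j refl _ (inj₂ (step .i j′ .j e)) = inj₁ (sym (trans (cong (walk i) e) (walk-interior i j′ refl)))

  walk-neighbours : ∀ i t → t < k → ∀ z → Adj B (walk i (suc t)) z →
                    z ≡ walk i t ⊎ z ≡ walk i (suc (suc t))
  walk-neighbours i t t<k z adj = p-neighbours i j (toℕ-fromℕ< t<k) z
    (subst (λ w → Adj B w z) (walk-interior i j (toℕ-fromℕ< t<k)) adj)
    where
    j : Fin k
    j = fromℕ< t<k

  u-neighbours : ∀ z → Adj B u z → z ≡ v ⊎ ∃[ i ] z ≡ walk i 1
  u-neighbours _ (inj₁ hinge)         = inj₁ refl
  u-neighbours _ (inj₁ (start i j e)) = inj₂ (i , sym (walk-interior i j e))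

  walk-fixed : (φ : Automorphism B) → ∀ i → Fixed φ u → Fixed φ (walk i 1) →
               ∀ t → t ≤ suc k → Fixed φ (walk i t)
  walk-fixed φ i = fixed-along-path φ (walk i) k (walk-adjacent i) (walk-neighbours i)

module UpperBound (k n : ℕ) where
  open BookGraph (suc (suc (suc (suc k)))) (suc (suc n))
  open PageWalk (suc (suc k)) (suc (suc n))

  firstVertices : List (BookV (suc (suc (suc (suc k)))) (suc (suc n)))
  firstVertices = map (λ i → p (fsuc i) fzero) (allFin (suc n))

  firstVertices-unique : Unique firstVertices
  firstVertices-unique =
    map⁺ (λ eq → suc-injective (just-injective (cong pageOf eq))) (allFin⁺ (suc n))

  length-firstVertices : length firstVertices ≡ suc n
  length-firstVertices = trans (length-map _ (allFin (suc n))) (length-tabulate (λ i → i))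

  module _ (φ : Automorphism B) (fixes : ∀ s → s ∈ firstVertices → apply φ s ≡ s) where

    first-fixed : ∀ i → Fixed φ (p (fsuc i) fzero)
    first-fixed i = fixes _ (∈-map⁺ _ (∈-allFin i))

    -- φ u is a neighbour of the fixed p 1 0, hence u or p 1 1; in the latter case φ would
    -- send the two neighbours v and p 0 0 of u to the single remaining neighbour of p 1 1.
    u-fixed : Fixed φ u
    u-fixed with walk-neighbours (fsuc fzero) 0 (s≤s z≤n) (apply φ u)
                   (apply-Adj-fixed φ (first-fixed fzero) (inj₂ (start (fsuc fzero) fzero refl)))
    ... | inj₁ φu≡u   = φu≡u
    ... | inj₂ φu≡p11 = ⊥-elim (v≢p00 (apply-injective φ (trans (lands-on-p12 v (inj₁ hinge) (λ ()))
                                   (sym (lands-on-p12 (p fzero fzero) (inj₁ (start fzero fzero refl)) (λ ()))))))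
      where
      v≢p00 : v ≢ p fzero fzero
      v≢p00 ()

      lands-on-p12 : ∀ x → Adj B u x → x ≢ p (fsuc fzero) fzero → apply φ x ≡ walk (fsuc fzero) 3
      lands-on-p12 x u~x x≢p10
        with walk-neighbours (fsuc fzero) 1 (s≤s (s≤s z≤n)) (apply φ x)
               (subst (λ w → Adj B w (apply φ x)) φu≡p11 (apply-Adj φ u~x))
      ... | inj₁ φx≡p10 = ⊥-elim (x≢p10 (apply-injective φ (trans φx≡p10 (sym (first-fixed fzero)))))
      ... | inj₂ φx≡p12 = φx≡p12

    v-fixed : Fixed φ v
    v-fixed = subst (Fixed φ) (walk-end (fsuc fzero))
      (walk-fixed φ (fsuc fzero) u-fixed (first-fixed fzero) _ ≤-refl)

    page-start-fixed : ∀ i → Fixed φ (walk i 1)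
    page-start-fixed (fsuc i) = first-fixed i
    page-start-fixed fzero    = fixed-neighbour φ u-fixed (inj₁ (start fzero fzero refl)) others
      where
      others : ∀ z → Adj B u z → z ≡ walk fzero 1 ⊎ Fixed φ z
      others z u~z with u-neighbours z u~z
      ... | inj₁ refl            = inj₂ v-fixed
      ... | inj₂ (fzero , refl)  = inj₁ refl
      ... | inj₂ (fsuc i , refl) = inj₂ (first-fixed i)

    all-fixed : ∀ x → Fixed φ x
    all-fixed (inj₁ fzero)        = u-fixed
    all-fixed (inj₁ (fsuc fzero)) = v-fixed
    all-fixed (inj₂ (i , j))      = subst (Fixed φ) (walk-interior i j refl)
      (walk-fixed φ i u-fixed (page-start-fixed i) (suc (toℕ j)) (m≤n⇒m≤1+n (toℕ<n j)))

  firstVertices-determining : IsDeterminingSet B firstVertices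
  firstVertices-determining = all-fixed

mainTheorem7 : ∀ m n → 2 ≤ n → 4 ≤ m → DetEquals (Book m n) (n ∸ 1)
mainTheorem7 (suc (suc (suc (suc k)))) (suc (suc n)) (s≤s (s≤s _)) (s≤s (s≤s (s≤s (s≤s _)))) =
  (firstVertices , firstVertices-unique , length-firstVertices , firstVertices-determining) ,
  (λ T _ determining → det-lower-bound (suc k) (suc n) T determining)
  where open UpperBound k n
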